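{- Let $h:[n]\to[n]$ be a Hessenberg function, $\lambda=(\lambda_1,\lambda_2)$ a composition of $n$ with two positive parts, $0\le k\le\lambda_2$, and let $f^{(k)}_\lambda:S_n\to\mathbb{C}[t_1,\dots,t_n]$ be the function defined below. Then: (1) $\{w\in S_n: f^{(k)}_\lambda(w)\ne0\}=\bigsqcup_{k\le j\le\lambda_2}S_\lambda v_j=\{w\in S_n: w\ge v_k\}$; (2) $y\cdot f^{(k)}_\lambda=f^{(k)}_\lambda$ for all $y\in S_\lambda$ (dot action); (3) $f^{(k)}_\lambda(yw)=y\big(f^{(k)}_\lambda(w)\big)$ for all $y\in S_\lambda$ and $w\in S_n$.
   Context: $[n]=\{1,\dots,n\}$; a Hessenberg function is a nondecreasing $h:[n]\to[n]$ with $h(i)\ge i$. $S_n$ acts on $\mathbb{C}[t_1,\dots,t_n]$ by ring automorphisms with $v(t_i)=t_{v(i)}$. Dot action on functions $f:S_n\to\mathbb{C}[t_1,\dots,t_n]$: $(v\cdot f)(w)=v(f(v^{ -1}w))$. Bruhat order is $\le$; $s_i$ is the transposition of $i,i+1$. $S_\lambda$ is generated by $s_i$, $i\ne\lambda_1$. ${}^\lambda S_n=\{v:v^{ -1}(1)<\dots<v^{ -1}(\lambda_1),\ v^{ -1}(\lambda_1+1)<\dots<v^{ -1}(n)\}$; each $w\in S_n$ is uniquely $w=yv$ with $y\in S_\lambda$, $v\in{}^\lambda S_n$. For $0\le j\le\lambda_2$, $v_j$ has one-line notation $[\lambda_1+1,\dots,\lambda_1+j,1,\lambda_1+j+1,\dots,n,2,\dots,\lambda_1]$.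 $\mathcal S_k=\{t_a-t_b:a<b,\ v_k^{ -1}(a)>v_k^{ -1}(b),\ v_k^{ -1}(a)\le h(v_k^{ -1}(b))\}$, and $f^{(k)}_\lambda(yv)=\prod_{t_a-t_b\in\mathcal S_k}(t_{y(a)}-t_{y(b)})$ if $v\ge v_k$ and $0$ otherwise ($y\in S_\lambda$, $v\in{}^\lambda S_n$). -}

module Defs where

open import Data.Nat as ℕ using (ℕ; zero; suc; _+_; _∸_)
import Data.Nat.Properties as ℕP
open import Data.Integer as ℤ using (ℤ)
open import Data.Fin as F using (Fin; toℕ; fromℕ<)
import Data.Fin.Properties as FP
open import Data.Fin.Permutation using (Permutation′; _⟨$⟩ʳ_; _⟨$⟩ˡ_; _∘ₚ_; flip)
import Data.Fin.Permutation.Components as PC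
open import Data.List using (List; []; _∷_; map; concatMap; filter; length; foldr; allFin)
open import Data.List.Base using ()
open import Data.Fin.Base using ()
open import Data.Product using (_×_; _,_; proj₁; proj₂; Σ; ∃)
open import Relation.Nullary using (Dec; yes; no; ¬_)
open import Relation.Nullary.Decidable using (_×-dec_)
open import Relation.Binary.PropositionalEquality using (_≡_; _≢_)

-- Conventions.  [n] = {1,…,n} is modelled by Fin n, the element
-- i : Fin n standing for toℕ i + 1.  Permutations of [n] are
-- stdlib permutations (Permutation′ n); w ⟨$⟩ʳ i is w(i) and
-- w ⟨$⟩ˡ i is w⁻¹(i).  Raw maps Fin n → Fin n are used where only the
-- one-line notation matters (e.g. Bruhat order, the v_j).

-- product of permutations as maps: (y · v)(i) = y (v i)
_·_ : ∀ {n} → Permutation′ n → Permutation′ n → Permutation′ n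
y · v = v ∘ₚ y

inv : ∀ {n} → Permutation′ n → Permutation′ n
inv = flip

_≗_ : ∀ {n} → (Fin n → Fin n) → (Fin n → Fin n) → Set
u ≗ w = ∀ i → u i ≡ w i

-- All polynomials occurring here have integer
-- coefficients; an integer polynomial is identified with the polynomial
-- function ℤ^n → ℤ it induces (faithful since ℤ is infinite), equality
-- being pointwise equality.

Poly : ℕ → Set
Poly n = (Fin n → ℤ) → ℤ

_≈P_ : ∀ {n} → Poly n → Poly n → Set
p ≈P q = ∀ x → p x ≡ q x

0P : ∀ {n} → Poly n
0P _ = ℤ.0ℤ

t : ∀ {n} → Fin n → Poly n
t a x = x a

-- action of S_n by ring automorphisms with v(t_i) = t_{v(i)}
act : ∀ {n} → Permutation′ n → Poly n → Poly n
act v p x = p (λ i → x (v ⟨$⟩ʳ i))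

pairs : ∀ n → List (Fin n × Fin n)
pairs n = concatMap (λ a → map (a ,_) (allFin n)) (allFin n)

len : ∀ {n} → (Fin n → Fin n) → ℕ
len {n} w = length (filter (λ ij → (proj₁ ij F.<? proj₂ ij) ×-dec (w (proj₂ ij) F.<? w (proj₁ ij))) (pairs n))

data Bruhat {n : ℕ} (u : Fin n → Fin n) : (Fin n → Fin n) → Set where
  br-refl : ∀ {w} → u ≗ w → Bruhat u w
  br-step : ∀ {w w'} → Bruhat u w → (i j : Fin n) → i F.< j →
            len w ℕ.< len (λ k → w (PC.transpose i j k)) →
            w' ≗ (λ k → w (PC.transpose i j k)) → Bruhat u w'

-- S_λ for λ = (λ₁, λ₂): the subgroup generated by the s_i, i ≠ λ₁
-- (s_i swaps i and i+1; in Fin-indexing it swaps i' and j' with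
-- toℕ j' = suc (toℕ i') and toℕ j' is the 1-based i).  Since the
-- generators are involutions, the generated subgroup is the set of
-- finite products of generators.
data InSλ {n : ℕ} (λ₁ : ℕ) : (Fin n → Fin n) → Set where
  sλ-id  : ∀ {y} → y ≗ (λ k → k) → InSλ λ₁ y
  sλ-mul : ∀ {y y'} → InSλ λ₁ y → (i j : Fin n) → toℕ j ≡ suc (toℕ i) →
           toℕ j ≢ λ₁ → y' ≗ (λ k → y (PC.transpose i j k)) → InSλ λ₁ y'

InλS : ∀ {n} (λ₁ : ℕ) → Permutation′ n → Set
InλS {n} λ₁ v =
  (∀ (a b : Fin n) → a F.< b → toℕ b ℕ.< λ₁ → (v ⟨$⟩ˡ a) F.< (v ⟨$⟩ˡ b)) ×
  (∀ (a b : Fin n) → λ₁ ℕ.≤ toℕ a → a F.< b → (v ⟨$⟩ˡ a) F.< (v ⟨$⟩ˡ b))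

-- ℕ → Fin n, with a fallback value (never used below for in-range input)
ix : ∀ {n} → ℕ → Fin n → Fin n
ix {n} m d with m ℕ.<? n
... | yes p = fromℕ< p
... | no _  = d

-- v_j = [λ₁+1,…,λ₁+j, 1, λ₁+j+1,…,n, 2,…,λ₁]  (0-based values below)
vℕ : (λ₁ λ₂ j p : ℕ) → ℕ
vℕ λ₁ λ₂ j p with p ℕ.<? j | p ℕ.≟ j | p ℕ.≤? λ₂
... | yes _ | _     | _     = λ₁ + p
... | no _  | yes _ | _     = 0
... | no _  | no _  | yes _ = λ₁ + p ∸ 1
... | no _  | no _  | no _  = p ∸ λ₂

vfun : ∀ {n} (λ₁ λ₂ j : ℕ) → Fin n → Fin n
vfun λ₁ λ₂ j p = ix (vℕ λ₁ λ₂ j (toℕ p)) p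

vinvℕ : (λ₁ λ₂ j a : ℕ) → ℕ
vinvℕ λ₁ λ₂ j a with a ℕ.≟ 0 | a ℕ.<? λ₁ | a ℕ.<? λ₁ + j
... | yes _ | _     | _     = j
... | no _  | yes _ | _     = a + λ₂
... | no _  | no _  | yes _ = a ∸ λ₁
... | no _  | no _  | no _  = a ∸ λ₁ + 1

vinv : ∀ {n} (λ₁ λ₂ j : ℕ) → Fin n → Fin n
vinv λ₁ λ₂ j a = ix (vinvℕ λ₁ λ₂ j (toℕ a)) a

Sk : ∀ {n} (λ₁ λ₂ : ℕ) (h : Fin n → Fin n) (k : ℕ) → List (Fin n × Fin n)
Sk {n} λ₁ λ₂ h k = filter (λ ab →
     (proj₁ ab F.<? proj₂ ab) ×-dec
     ((vinv λ₁ λ₂ k (proj₂ ab) F.<? vinv λ₁ λ₂ k (proj₁ ab)) ×-dec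
      (vinv λ₁ λ₂ k (proj₁ ab) F.≤? h (vinv λ₁ λ₂ k (proj₂ ab)))))
  (pairs n)

prodSk : ∀ {n} (λ₁ λ₂ : ℕ) (h : Fin n → Fin n) (k : ℕ) → Permutation′ n → Poly n
prodSk λ₁ λ₂ h k y x =
  foldr (λ ab r → (x (y ⟨$⟩ʳ proj₁ ab) ℤ.- x (y ⟨$⟩ʳ proj₂ ab)) ℤ.* r) ℤ.1ℤ
        (Sk λ₁ λ₂ h k)

IsHessenberg : ∀ {n} → (Fin n → Fin n) → Set
IsHessenberg {n} h = (∀ (i j : Fin n) → i F.≤ j → h i F.≤ h j) × (∀ i → i F.≤ h i)

-- f : S_n → C[t] is f^{(k)}_λ: the function defined by
-- f(yv) = ∏ … if v ≥ v_k and 0 otherwise (y ∈ S_λ, v ∈ ^λS_n).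
-- (Well-defined since the decomposition w = yv is unique; we also ask
-- that f only depends on w as a map.)
IsF : ∀ {n} (λ₁ λ₂ : ℕ) (h : Fin n → Fin n) (k : ℕ) → (Permutation′ n → Poly n) → Set
IsF {n} λ₁ λ₂ h k f =
  (∀ (w w' : Permutation′ n) → (∀ i → w ⟨$⟩ʳ i ≡ w' ⟨$⟩ʳ i) → f w ≈P f w') ×
  (∀ (y v : Permutation′ n) → InSλ λ₁ (y ⟨$⟩ʳ_) → InλS λ₁ v →
     (Bruhat (vfun λ₁ λ₂ k) (v ⟨$⟩ʳ_) → f (y · v) ≈P prodSk λ₁ λ₂ h k y) ×
     (¬ Bruhat (vfun λ₁ λ₂ k) (v ⟨$⟩ʳ_) → f (y · v) ≈P 0P))

InCoset : ∀ {n} (λ₁ λ₂ j : ℕ) → Permutation′ n → Set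
InCoset {n} λ₁ λ₂ j w =
  Σ (Fin n → Fin n) λ y → InSλ λ₁ y × (∀ i → w ⟨$⟩ʳ i ≡ y (vfun λ₁ λ₂ j i))

{-# OPTIONS --safe #-}
-- Write n = λ₁ + λ₂ and call the values 1, …, λ₁ the lower block and λ₁ + 1, …, n the upper block.
-- For k ≤ λ₂, w ≥ v_k in the Bruhat order iff w sends the first k positions into the upper block
-- and the positions after λ₂ + 1 into the lower block. This pattern holds for v_k, survives every
-- Bruhat step upwards (such a step swaps an ascent), and is invariant under S_λ acting on values,
-- since S_λ preserves the blocks. Conversely, every w factors as w = y v with y ∈ S_λ, v ∈ ^λS_n and
-- v ≤ w, and a minimal coset representative v with the pattern is forced to be some v_j with
-- k ≤ j ≤ λ₂, while v_k ≤ v_{k+1} ≤ … ≤ v_j. Hence f(y v) ≠ 0 ⇔ v ≥ v_k ⇔ w ≥ v_k ⇔ w ∈ S_λ v_j for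
-- some j ≥ k; these cosets are distinct because v_j is the only one with a lower value at position
-- j + 1. Finally y(∏ (t_a - t_b)) = ∏ (t_{y(a)} - t_{y(b)}), so f(y y′ v) = y(f(y′ v)), which gives
-- (2) and (3).
module Submission where

open import Defs
open import Data.Nat using (ℕ; _≤_; _+_)
open import Data.Fin using (Fin)
open import Data.Fin.Permutation using (Permutation′; _⟨$⟩ʳ_)
open import Data.Product using (_×_; Σ)
open import Relation.Nullary using (¬_)
open import Relation.Binary.PropositionalEquality using (_≡_)
open import Function.Bundles using (_⇔_)

open import Data.Nat as ℕ using (zero; suc; _*_; _∸_; z≤n; s≤s; _<_)
import Data.Nat.Properties as NP
open import Data.Nat.Induction using (<-wellFounded)
open import Data.Fin as F using (toℕ)
import Data.Fin.Properties as FP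
import Data.Fin.Permutation as Perm
open import Data.Fin.Permutation using (_⟨$⟩ˡ_; _∘ₚ_)
open import Data.Fin.Permutation.Components using (transpose; transpose-inverse)
open import Data.Integer as ℤ using (ℤ)
import Data.Integer.Properties as ZP
open import Data.List using (List; []; _∷_; map; filter; length; foldr; tabulate; concat; allFin; _++_)
import Data.List.Properties as LP
open import Data.List.Relation.Unary.All as All using (All; []; _∷_)
import Data.List.Relation.Unary.All.Properties as AllP
open import Data.Product using (_,_; proj₁; proj₂; ∃₂)
open import Data.Sum using (inj₁; inj₂)
open import Data.Empty using (⊥-elim)
open import Function using (_∘_)
open import Function.Bundles using (Equivalence; mk⇔)
open import Function.Properties.Equivalence using () renaming (refl to ⇔-refl; sym to ⇔-sym; trans to ⇔-trans)
open import Induction.WellFounded using (Acc; acc)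
open import Relation.Nullary using (Dec; yes; no; ¬?)
open import Relation.Nullary.Decidable as Dec using (dec-true; dec-false; _×-dec_; _→-dec_)
open import Relation.Binary using (Tri; tri<; tri≈; tri>)
open import Relation.Binary.PropositionalEquality
  using (_≢_; refl; sym; trans; cong; cong₂; subst; subst₂; module ≡-Reasoning)
open import Algebra.Properties.CommutativeMonoid.Sum NP.+-0-commutativeMonoid
  using (sum; sum-cong-≗; ∑-distrib-+; sum-permute)

transpose-atˡ : ∀ {n} (i j : Fin n) → transpose i j i ≡ j
transpose-atˡ i j rewrite dec-true (i FP.≟ i) refl = refl

transpose-atʳ : ∀ {n} (i j : Fin n) → transpose i j j ≡ i
transpose-atʳ i j with j FP.≟ i
... | yes j≡i = j≡i
... | no j≢i rewrite dec-true (j FP.≟ j) refl = refl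

transpose-other : ∀ {n} {i j k : Fin n} → k ≢ i → k ≢ j → transpose i j k ≡ k
transpose-other {i = i} {j} {k} k≢i k≢j
  rewrite dec-false (k FP.≟ i) k≢i | dec-false (k FP.≟ j) k≢j = refl

data TransposeView {n} (i j : Fin n) : Fin n → Fin n → Set where
  at-i  : TransposeView i j i j
  at-j  : TransposeView i j j i
  other : ∀ {k} → k ≢ i → k ≢ j → TransposeView i j k k

transpose-view : ∀ {n} (i j k : Fin n) → TransposeView i j k (transpose i j k)
transpose-view i j k = view (k FP.≟ i) (k FP.≟ j)
  where
  view : Dec (k ≡ i) → Dec (k ≡ j) → TransposeView i j k (transpose i j k)
  view (yes refl) _        = subst (TransposeView k j k) (sym (transpose-atˡ k j)) at-i
  view (no _)     (yes refl) = subst (TransposeView i k k) (sym (transpose-atʳ i k)) at-j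
  view (no k≢i)   (no k≢j)   = subst (TransposeView i j k) (sym (transpose-other k≢i k≢j)) (other k≢i k≢j)

transpose-involutive : ∀ {n} (i j k : Fin n) → transpose i j (transpose i j k) ≡ k
transpose-involutive i j k with transpose i j k | transpose-view i j k
... | _ | at-i          = transpose-atʳ i j
... | _ | at-j          = transpose-atˡ i j
... | _ | other k≢i k≢j = transpose-other k≢i k≢j

⟨$⟩ʳ-injective : ∀ {n} (w : Permutation′ n) {x y : Fin n} → w ⟨$⟩ʳ x ≡ w ⟨$⟩ʳ y → x ≡ y
⟨$⟩ʳ-injective w {x} {y} e = begin
  x                      ≡⟨ Perm.inverseˡ w ⟨
  w ⟨$⟩ˡ (w ⟨$⟩ʳ x)      ≡⟨ cong (w ⟨$⟩ˡ_) e ⟩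
  w ⟨$⟩ˡ (w ⟨$⟩ʳ y)      ≡⟨ Perm.inverseˡ w ⟩
  y                      ∎
  where open ≡-Reasoning

transpose-conjugate : ∀ {n} (w : Permutation′ n) (a b x : Fin n) →
  w ⟨$⟩ʳ transpose a b x ≡ transpose (w ⟨$⟩ʳ a) (w ⟨$⟩ʳ b) (w ⟨$⟩ʳ x)
transpose-conjugate w a b x with transpose a b x | transpose-view a b x
... | _ | at-i          = sym (transpose-atˡ (w ⟨$⟩ʳ a) (w ⟨$⟩ʳ b))
... | _ | at-j          = sym (transpose-atʳ (w ⟨$⟩ʳ a) (w ⟨$⟩ʳ b))
... | _ | other x≢a x≢b = sym (transpose-other (x≢a ∘ ⟨$⟩ʳ-injective w) (x≢b ∘ ⟨$⟩ʳ-injective w))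

ix-val : ∀ {n} {m} (d : Fin n) → m < n → toℕ (ix m d) ≡ m
ix-val {n} {m} d m<n with m ℕ.<? n
... | yes m<n′ = FP.toℕ-fromℕ< m<n′
... | no m≮n   = ⊥-elim (m≮n m<n)

ix-toℕ : ∀ {n} (x d : Fin n) → ix (toℕ x) d ≡ x
ix-toℕ x d = FP.toℕ-injective (ix-val d (FP.toℕ<n x))

sum-mono-≤ : ∀ {n} {f g : Fin n → ℕ} → (∀ a → f a ≤ g a) → sum f ≤ sum g
sum-mono-≤ {zero}  f≤g = z≤n
sum-mono-≤ {suc n} f≤g = NP.+-mono-≤ (f≤g F.zero) (sum-mono-≤ (f≤g ∘ F.suc))

sum-mono-< : ∀ {n} {f g : Fin n → ℕ} → (∀ a → f a ≤ g a) → ∀ i → f i < g i → sum f < sum g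
sum-mono-< f≤g F.zero    fi<gi = NP.+-mono-<-≤ fi<gi (sum-mono-≤ (f≤g ∘ F.suc))
sum-mono-< f≤g (F.suc i) fi<gi = NP.+-mono-≤-< (f≤g F.zero) (sum-mono-< (f≤g ∘ F.suc) i fi<gi)

sum-transpose : ∀ {n} (i j : Fin n) (f : Fin n → ℕ) → sum (f ∘ transpose i j) ≡ sum f
sum-transpose i j f = sym (sum-permute f (Perm.transpose i j))

ΣΣ : ∀ {n} → (Fin n → Fin n → ℕ) → ℕ
ΣΣ F = sum (λ a → sum (F a))

ΣΣ-cong : ∀ {n} {F G : Fin n → Fin n → ℕ} → (∀ a b → F a b ≡ G a b) → ΣΣ F ≡ ΣΣ G
ΣΣ-cong F≡G = sum-cong-≗ (λ a → sum-cong-≗ (F≡G a))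

ΣΣ-distrib-+ : ∀ {n} (F G : Fin n → Fin n → ℕ) → ΣΣ (λ a b → F a b + G a b) ≡ ΣΣ F + ΣΣ G
ΣΣ-distrib-+ F G = trans (sum-cong-≗ (λ a → ∑-distrib-+ (F a) (G a)))
                          (∑-distrib-+ (λ a → sum (F a)) (λ a → sum (G a)))

ΣΣ-transpose : ∀ {n} (i j : Fin n) (F : Fin n → Fin n → ℕ) →
  ΣΣ (λ a b → F (transpose i j a) (transpose i j b)) ≡ ΣΣ F
ΣΣ-transpose i j F = trans (sum-cong-≗ (λ a → sum-transpose i j (F (transpose i j a))))
                           (sum-transpose i j (λ a → sum (F a)))

ΣΣ-mono-< : ∀ {n} {F G : Fin n → Fin n → ℕ} → (∀ a b → F a b ≤ G a b) →
  ∀ i j → F i j < G i j → ΣΣ F < ΣΣ G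
ΣΣ-mono-< F≤G i j lt = sum-mono-< (λ a → sum-mono-≤ (F≤G a)) i (sum-mono-< (F≤G i) j lt)

-- Inversions and length

indicator : ∀ {p} {P : Set p} → Dec P → ℕ
indicator (yes _) = 1
indicator (no _)  = 0

indicator-×-dec : ∀ {p q} {P : Set p} {Q : Set q} (P? : Dec P) (Q? : Dec Q) →
  indicator (P? ×-dec Q?) ≡ indicator P? * indicator Q?
indicator-×-dec (yes _) (yes _) = refl
indicator-×-dec (yes _) (no _)  = refl
indicator-×-dec (no _)  _       = refl

length-filter-tabulate : ∀ {A : Set} {P : A → Set} (P? : ∀ x → Dec (P x)) {n} (f : Fin n → A) →
  length (filter P? (tabulate f)) ≡ sum (indicator ∘ P? ∘ f)
length-filter-tabulate P? {zero}  f = refl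
length-filter-tabulate P? {suc n} f with P? (f F.zero)
... | yes _ = cong suc (length-filter-tabulate P? (f ∘ F.suc))
... | no _  = length-filter-tabulate P? (f ∘ F.suc)

length-filter-concat-tabulate : ∀ {A : Set} {P : A → Set} (P? : ∀ x → Dec (P x)) {n}
  (g : Fin n → List A) →
  length (filter P? (concat (tabulate g))) ≡ sum (λ a → length (filter P? (g a)))
length-filter-concat-tabulate P? {zero}  g = refl
length-filter-concat-tabulate P? {suc n} g = begin
  length (filter P? (g F.zero ++ rest))
    ≡⟨ cong length (LP.filter-++ P? (g F.zero) rest) ⟩
  length (filter P? (g F.zero) ++ filter P? rest)
    ≡⟨ LP.length-++ (filter P? (g F.zero)) ⟩
  length (filter P? (g F.zero)) + length (filter P? rest)
    ≡⟨ cong (length (filter P? (g F.zero)) +_) (length-filter-concat-tabulate P? (g ∘ F.suc)) ⟩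
  sum (λ a → length (filter P? (g a))) ∎
  where
  open ≡-Reasoning
  rest = concat (tabulate (g ∘ F.suc))

inversion : ∀ {n} → (Fin n → Fin n) → Fin n → Fin n → ℕ
inversion w a b = indicator (a F.<? b) * indicator (w b F.<? w a)

len≡ΣΣ-inversion : ∀ {n} (w : Fin n → Fin n) → len w ≡ ΣΣ (inversion w)
len≡ΣΣ-inversion {n} w = begin
  length (filter D? (concat (map row (tabulate (λ a → a)))))
    ≡⟨ cong (length ∘ filter D? ∘ concat) (LP.map-tabulate (λ a → a) row) ⟩
  length (filter D? (concat (tabulate row)))
    ≡⟨ length-filter-concat-tabulate D? row ⟩
  sum (λ a → length (filter D? (row a)))
    ≡⟨ sum-cong-≗ (λ a → cong (length ∘ filter D?) (LP.map-tabulate (λ b → b) (a ,_))) ⟩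
  sum (λ a → length (filter D? (tabulate (a ,_))))
    ≡⟨ sum-cong-≗ (λ a → length-filter-tabulate D? (a ,_)) ⟩
  ΣΣ (λ a b → indicator (D? (a , b)))
    ≡⟨ ΣΣ-cong (λ a b → indicator-×-dec (a F.<? b) (w b F.<? w a)) ⟩
  ΣΣ (inversion w) ∎
  where
  open ≡-Reasoning
  D? : (ab : Fin n × Fin n) → Dec _
  D? (a , b) = (a F.<? b) ×-dec (w b F.<? w a)
  row : Fin n → List (Fin n × Fin n)
  row a = map (a ,_) (allFin n)

len-cong : ∀ {n} {u w : Fin n → Fin n} → u ≗ w → len u ≡ len w
len-cong {u = u} {w} u≗w = begin
  len u
    ≡⟨ len≡ΣΣ-inversion u ⟩
  ΣΣ (inversion u)
    ≡⟨ ΣΣ-cong (λ a b → cong₂ (λ x y → indicator (a F.<? b) * indicator (x F.<? y)) (u≗w b) (u≗w a)) ⟩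
  ΣΣ (inversion w)
    ≡⟨ len≡ΣΣ-inversion w ⟨
  len w ∎
  where open ≡-Reasoning

indicator-exchange-≤ : ∀ {P₁ P₂ P₃ P₄ : Set} (A : Dec P₁) (B : Dec P₂) (X : Dec P₃) (Y : Dec P₄) →
  (P₁ → ¬ P₂ → P₃ → P₄) → (¬ P₁ → P₂ → P₄ → P₃) →
  indicator A * indicator X + indicator B * indicator Y ≤ indicator A * indicator Y + indicator B * indicator X
indicator-exchange-≤ (yes _) (yes _) X Y _ _ = NP.≤-reflexive (NP.+-comm (indicator X + 0) (indicator Y + 0))
indicator-exchange-≤ (no _)  (no _)  X Y _ _ = z≤n
indicator-exchange-≤ (yes _) (no _)  (no _)  Y _ _ = z≤n
indicator-exchange-≤ (yes _) (no _)  (yes _) (yes _) _ _ = NP.≤-refl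
indicator-exchange-≤ (yes a) (no ¬b) (yes x) (no ¬y) X⇒Y _ = ⊥-elim (¬y (X⇒Y a ¬b x))
indicator-exchange-≤ (no _)  (yes _) X (no _) _ _ = z≤n
indicator-exchange-≤ (no _)  (yes _) (yes _) (yes _) _ _ = NP.≤-refl
indicator-exchange-≤ (no ¬a) (yes b) (no ¬x) (yes y) _ Y⇒X = ⊥-elim (¬x (Y⇒X ¬a b y))

indicator-exchange-< : ∀ {P₁ P₂ P₃ P₄ : Set} (A : Dec P₁) (B : Dec P₂) (X : Dec P₃) (Y : Dec P₄) →
  P₁ → ¬ P₂ → ¬ P₃ → P₄ →
  indicator A * indicator X + indicator B * indicator Y < indicator A * indicator Y + indicator B * indicator X
indicator-exchange-< (yes _) (no _)  (no _)  (yes _) _ _  _  _ = s≤s z≤n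
indicator-exchange-< (no ¬a) _       _       _       a _  _  _ = ⊥-elim (¬a a)
indicator-exchange-< (yes _) (yes b) _       _       _ ¬b _  _ = ⊥-elim (¬b b)
indicator-exchange-< (yes _) (no _)  (yes x) _       _ _  ¬x _ = ⊥-elim (¬x x)
indicator-exchange-< (yes _) (no _)  (no _)  (no ¬y) _ _  _  y = ⊥-elim (¬y y)

half-< : ∀ m k → m + m < k + k → m < k
half-< m k 2m<2k with m ℕ.<? k
... | yes m<k = m<k
... | no m≮k  = ⊥-elim (NP.<⇒≱ 2m<2k (NP.+-mono-≤ (NP.≮⇒≥ m≮k) (NP.≮⇒≥ m≮k)))

module _ {n} (w : Fin n → Fin n) {i j : Fin n} (i<j : i F.< j) (wi<wj : w i F.< w j) where
  private
    τ = transpose i j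

    w≤w∘τ : ∀ x → x ≢ j → toℕ (w x) ≤ toℕ (w (τ x))
    w≤w∘τ x x≢j with τ x | transpose-view i j x
    ... | _ | at-i        = NP.<⇒≤ wi<wj
    ... | _ | at-j        = ⊥-elim (x≢j refl)
    ... | _ | other _ _   = NP.≤-refl

    w∘τ≤w : ∀ x → x ≢ i → toℕ (w (τ x)) ≤ toℕ (w x)
    w∘τ≤w x x≢i with τ x | transpose-view i j x
    ... | _ | at-i        = ⊥-elim (x≢i refl)
    ... | _ | at-j        = NP.<⇒≤ wi<wj
    ... | _ | other _ _   = NP.≤-refl

    inversion-persists : ∀ a b → a F.< b → ¬ (τ a F.< τ b) → w b F.< w a → w (τ b) F.< w (τ a)
    inversion-persists a b a<b τb≤τa wb<wa =
      NP.≤-<-trans (w∘τ≤w b b≢i) (NP.<-≤-trans wb<wa (w≤w∘τ a a≢j))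
      where
      b≢i : b ≢ i
      b≢i refl = τb≤τa (subst₂ F._<_ (sym (transpose-other (FP.<⇒≢ a<b) (FP.<⇒≢ (FP.<-trans a<b i<j))))
                                     (sym (transpose-atˡ b j)) (FP.<-trans a<b i<j))
      a≢j : a ≢ j
      a≢j refl = τb≤τa (subst₂ F._<_ (sym (transpose-atʳ i a))
                                     (sym (transpose-other (b≢i) (FP.<⇒≢ a<b ∘ sym))) (FP.<-trans i<j a<b))

    inversion-returns : ∀ a b → ¬ (a F.< b) → τ a F.< τ b → w (τ b) F.< w (τ a) → w b F.< w a
    inversion-returns a b b≤a τa<τb =
      subst₂ (λ x y → w x F.< w y) (transpose-involutive i j b) (transpose-involutive i j a)
      ∘ inversion-persists (τ a) (τ b) τa<τb
          (b≤a ∘ subst₂ F._<_ (transpose-involutive i j a) (transpose-involutive i j b))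

  -- Double counting: summing inversion w over all pairs and over their τ-images gives 2 len w;
  -- exchanging w and w ∘ τ in the second factors gives 2 len (w ∘ τ), and the two sums compare
  -- pairwise (indicator-exchange-≤), strictly at (i, j).
  len-transpose-ascent : len w < len (w ∘ τ)
  len-transpose-ascent = half-< (len w) (len (w ∘ τ)) (subst₂ _<_ ΣΣ-before ΣΣ-after ΣΣ-<)
    where
    open ≡-Reasoning
    before after : Fin n → Fin n → ℕ
    before a b = inversion w a b + inversion w (τ a) (τ b)
    after a b = indicator (a F.<? b) * indicator (w (τ b) F.<? w (τ a))
              + indicator (τ a F.<? τ b) * indicator (w b F.<? w a)
    ΣΣ-< : ΣΣ before < ΣΣ after
    ΣΣ-< = ΣΣ-mono-<
      (λ a b → indicator-exchange-≤ (a F.<? b) (τ a F.<? τ b) (w b F.<? w a) (w (τ b) F.<? w (τ a))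
                 (inversion-persists a b) (inversion-returns a b))
      i j
      (indicator-exchange-< (i F.<? j) (τ i F.<? τ j) (w j F.<? w i) (w (τ j) F.<? w (τ i))
        i<j
        (FP.<-asym i<j ∘ subst₂ F._<_ (transpose-atˡ i j) (transpose-atʳ i j))
        (FP.<-asym wi<wj)
        (subst₂ (λ x y → w x F.< w y) (sym (transpose-atʳ i j)) (sym (transpose-atˡ i j)) wi<wj))
    ΣΣ-before : ΣΣ before ≡ len w + len w
    ΣΣ-before = begin
      ΣΣ before
        ≡⟨ ΣΣ-distrib-+ (inversion w) _ ⟩
      ΣΣ (inversion w) + ΣΣ (λ a b → inversion w (τ a) (τ b))
        ≡⟨ cong (ΣΣ (inversion w) +_) (ΣΣ-transpose i j (inversion w)) ⟩
      ΣΣ (inversion w) + ΣΣ (inversion w)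
        ≡⟨ cong₂ _+_ (len≡ΣΣ-inversion w) (len≡ΣΣ-inversion w) ⟨
      len w + len w ∎
    ΣΣ-after : ΣΣ after ≡ len (w ∘ τ) + len (w ∘ τ)
    ΣΣ-after = begin
      ΣΣ after
        ≡⟨ ΣΣ-distrib-+ (inversion (w ∘ τ)) _ ⟩
      ΣΣ (inversion (w ∘ τ)) + ΣΣ (λ a b → indicator (τ a F.<? τ b) * indicator (w b F.<? w a))
        ≡⟨ cong (ΣΣ (inversion (w ∘ τ)) +_) (ΣΣ-cong (λ a b →
             cong₂ (λ x y → indicator (τ a F.<? τ b) * indicator (w x F.<? w y))
                   (sym (transpose-involutive i j b)) (sym (transpose-involutive i j a)))) ⟩
      ΣΣ (inversion (w ∘ τ)) + ΣΣ (λ a b → inversion (w ∘ τ) (τ a) (τ b))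
        ≡⟨ cong (ΣΣ (inversion (w ∘ τ)) +_) (ΣΣ-transpose i j (inversion (w ∘ τ))) ⟩
      ΣΣ (inversion (w ∘ τ)) + ΣΣ (inversion (w ∘ τ))
        ≡⟨ cong₂ _+_ (len≡ΣΣ-inversion (w ∘ τ)) (len≡ΣΣ-inversion (w ∘ τ)) ⟨
      len (w ∘ τ) + len (w ∘ τ) ∎

len-<⇒ascent : ∀ {n} (w : Fin n → Fin n) {i j : Fin n} → i F.< j →
  len w < len (w ∘ transpose i j) → w i F.< w j
len-<⇒ascent w {i} {j} i<j len< with FP.<-cmp (w i) (w j)
... | tri< wi<wj _ _ = wi<wj
... | tri≈ _ wi≡wj _ = ⊥-elim (NP.<-irrefl (sym (len-cong w∘τ≗w)) len<)
  where
  w∘τ≗w : (w ∘ transpose i j) ≗ w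
  w∘τ≗w x with transpose i j x | transpose-view i j x
  ... | _ | at-i      = sym wi≡wj
  ... | _ | at-j      = wi≡wj
  ... | _ | other _ _ = refl
... | tri> _ _ wj<wi = ⊥-elim (NP.<-asym len< (subst (len (w ∘ τ) <_) (len-cong τ∘τ) len-back<))
  where
  τ = transpose i j
  len-back< : len (w ∘ τ) < len (w ∘ τ ∘ τ)
  len-back< = len-transpose-ascent (w ∘ τ) i<j
    (subst₂ (λ x y → w x F.< w y) (sym (transpose-atˡ i j)) (sym (transpose-atʳ i j)) wj<wi)
  τ∘τ : (w ∘ τ ∘ τ) ≗ w
  τ∘τ x = cong w (transpose-involutive i j x)

bruhat-cong : ∀ {n} {u v w : Fin n → Fin n} → Bruhat u v → v ≗ w → Bruhat u w
bruhat-cong (br-refl u≗v) v≗w = br-refl (λ k → trans (u≗v k) (v≗w k))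
bruhat-cong (br-step u≤v i j i<j len< e) v≗w = br-step u≤v i j i<j len< (λ k → trans (sym (v≗w k)) (e k))

bruhat-trans : ∀ {n} {u v w : Fin n → Fin n} → Bruhat u v → Bruhat v w → Bruhat u w
bruhat-trans u≤v (br-refl v≗w)               = bruhat-cong u≤v v≗w
bruhat-trans u≤v (br-step v≤w i j i<j len< e) = br-step (bruhat-trans u≤v v≤w) i j i<j len< e

IncreasingOn : ℕ → ℕ → (ℕ → ℕ) → Set
IncreasingOn lo hi f = ∀ {m} → lo ≤ m → suc m < hi → f m < f (suc m)

increasing-< : ∀ {lo hi f} → IncreasingOn lo hi f → ∀ {a b} → lo ≤ a → a < b → b < hi → f a < f b
increasing-< {f = f} inc {a} {suc b} lo≤a a<1+b 1+b<hi with a ℕ.≟ b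
... | yes refl = inc lo≤a 1+b<hi
... | no a≢b   = NP.<-trans (increasing-< inc lo≤a a<b (NP.<-trans (NP.n<1+n b) 1+b<hi))
                            (inc (NP.≤-trans lo≤a (NP.<⇒≤ a<b)) 1+b<hi)
  where a<b = NP.≤∧≢⇒< (NP.≤-pred a<1+b) a≢b

increasing-+ : ∀ {d f} → IncreasingOn 0 d f → ∀ a e → a + e < d → f a + e ≤ f (a + e)
increasing-+ {f = f} inc a zero a+0<d =
  NP.≤-reflexive (trans (NP.+-identityʳ (f a)) (cong f (sym (NP.+-identityʳ a))))
increasing-+ {d} {f} inc a (suc e) a+1+e<d = begin
  f a + suc e       ≡⟨ NP.+-suc (f a) e ⟩
  suc (f a + e)     ≤⟨ s≤s (increasing-+ inc a e (NP.<-trans (NP.+-monoʳ-< a (NP.n<1+n e)) a+1+e<d)) ⟩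
  suc (f (a + e))   ≤⟨ inc z≤n (subst (_< d) (NP.+-suc a e) a+1+e<d) ⟩
  f (suc (a + e))   ≡⟨ cong f (NP.+-suc a e) ⟨
  f (a + suc e)     ∎
  where open NP.≤-Reasoning

increasing-in-interval : ∀ {d f α} → IncreasingOn 0 d f → (∀ {m} → m < d → α ≤ f m × f m < α + d) →
  ∀ {m} → m < d → f m ≡ α + m
increasing-in-interval {suc d′} {f} {α} inc bounds {m} m<d = NP.≤-antisym upper lower
  where
  e = d′ ∸ m
  m+e≡d′ : m + e ≡ d′
  m+e≡d′ = NP.m+[n∸m]≡n (NP.≤-pred m<d)
  lower : α + m ≤ f m
  lower = NP.≤-trans (NP.+-monoˡ-≤ m (proj₁ (bounds (s≤s z≤n)))) (increasing-+ inc 0 m m<d)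
  upper : f m ≤ α + m
  upper = NP.+-cancelʳ-≤ e (f m) (α + m) (begin
    f m + e         ≤⟨ increasing-+ inc m e (subst (_< suc d′) (sym m+e≡d′) (NP.n<1+n d′)) ⟩
    f (m + e)       ≡⟨ cong f m+e≡d′ ⟩
    f d′            ≤⟨ NP.≤-pred (subst (f d′ <_) (NP.+-suc α d′) (proj₂ (bounds (NP.n<1+n d′)))) ⟩
    α + d′          ≡⟨ cong (α +_) m+e≡d′ ⟨
    α + (m + e)     ≡⟨ NP.+-assoc α m e ⟨
    α + m + e       ∎)
    where open NP.≤-Reasoning

skip : ℕ → ℕ → ℕ
skip j m with m ℕ.<? j
... | yes _ = m
... | no _  = suc m

skip-below : ∀ {j m} → m < j → skip j m ≡ m
skip-below {j} {m} m<j with m ℕ.<? j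
... | yes _  = refl
... | no m≮j = ⊥-elim (m≮j m<j)

skip-above : ∀ {j m} → j ≤ m → skip j m ≡ suc m
skip-above {j} {m} j≤m with m ℕ.<? j
... | yes m<j = ⊥-elim (NP.<⇒≱ m<j j≤m)
... | no _    = refl

skip-≢ : ∀ j m → skip j m ≢ j
skip-≢ j m with m ℕ.<? j
... | yes m<j = NP.<⇒≢ m<j
... | no m≮j  = λ 1+m≡j → m≮j (subst (m <_) 1+m≡j (NP.n<1+n m))

skip-≤ : ∀ {j m d} → m < d → skip j m ≤ d
skip-≤ {j} {m} m<d with m ℕ.<? j
... | yes _ = NP.<⇒≤ m<d
... | no _  = m<d

skip-increasing : ∀ j m → skip j m < skip j (suc m)
skip-increasing j m with m ℕ.<? j | suc m ℕ.<? j
... | yes _   | yes _    = NP.n<1+n m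
... | yes _   | no _     = NP.m<n⇒m<1+n (NP.n<1+n m)
... | no m≮j  | yes 1+m<j = ⊥-elim (m≮j (NP.<-trans (NP.n<1+n m) 1+m<j))
... | no _    | no _     = NP.n<1+n (suc m)

-- The Young subgroup S_λ and minimal coset representatives

SameBlock : ∀ {n} → ℕ → Fin n → Fin n → Set
SameBlock λ₁ a b = (toℕ a < λ₁) ⇔ (toℕ b < λ₁)

sameBlock-large : ∀ {n λ₁} {a b : Fin n} → SameBlock λ₁ a b → λ₁ ≤ toℕ a → λ₁ ≤ toℕ b
sameBlock-large a~b λ₁≤a = NP.≮⇒≥ (NP.≤⇒≯ λ₁≤a ∘ Equivalence.from a~b)

small-sameBlock : ∀ {n λ₁} {a b : Fin n} → toℕ a < λ₁ → toℕ b < λ₁ → SameBlock λ₁ a b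
small-sameBlock a<λ₁ b<λ₁ = mk⇔ (λ _ → b<λ₁) (λ _ → a<λ₁)

large-sameBlock : ∀ {n λ₁} {a b : Fin n} → λ₁ ≤ toℕ a → λ₁ ≤ toℕ b → SameBlock λ₁ a b
large-sameBlock λ₁≤a λ₁≤b = mk⇔ (⊥-elim ∘ NP.≤⇒≯ λ₁≤a) (⊥-elim ∘ NP.≤⇒≯ λ₁≤b)

adjacent-sameBlock : ∀ {n λ₁} {i j : Fin n} → toℕ j ≡ suc (toℕ i) → toℕ j ≢ λ₁ → SameBlock λ₁ i j
adjacent-sameBlock {λ₁ = λ₁} {i} j≡1+i j≢λ₁ =
  mk⇔ (λ i<λ₁ → NP.≤∧≢⇒< (subst (_≤ λ₁) (sym j≡1+i) i<λ₁) j≢λ₁)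
      (λ j<λ₁ → NP.<-trans (subst (toℕ i <_) (sym j≡1+i) (NP.n<1+n (toℕ i))) j<λ₁)

transpose-sameBlock : ∀ {n λ₁} {i j : Fin n} → toℕ j ≡ suc (toℕ i) → toℕ j ≢ λ₁ →
  ∀ x → SameBlock λ₁ (transpose i j x) x
transpose-sameBlock {i = i} {j} j≡1+i j≢λ₁ x with transpose i j x | transpose-view i j x
... | _ | at-i      = ⇔-sym (adjacent-sameBlock j≡1+i j≢λ₁)
... | _ | at-j      = adjacent-sameBlock j≡1+i j≢λ₁
... | _ | other _ _ = ⇔-refl

InSλ⇒sameBlock : ∀ {n λ₁} {y : Fin n → Fin n} → InSλ λ₁ y → ∀ x → SameBlock λ₁ (y x) x
InSλ⇒sameBlock {λ₁ = λ₁} (sλ-id y≗id) x = subst (λ z → SameBlock λ₁ z x) (sym (y≗id x)) ⇔-refl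
InSλ⇒sameBlock {λ₁ = λ₁} (sλ-mul {y = y} y∈ i j j≡1+i j≢λ₁ e) x =
  subst (λ z → SameBlock λ₁ z x) (sym (e x))
        (⇔-trans (InSλ⇒sameBlock y∈ (transpose i j x)) (transpose-sameBlock j≡1+i j≢λ₁ x))

InSλ-cong : ∀ {n λ₁} {y y′ : Fin n → Fin n} → y ≗ y′ → InSλ λ₁ y → InSλ λ₁ y′
InSλ-cong y≗y′ (sλ-id y≗id)              = sλ-id (λ k → trans (sym (y≗y′ k)) (y≗id k))
InSλ-cong y≗y′ (sλ-mul y∈ i j j≡1+i j≢λ₁ e) = sλ-mul y∈ i j j≡1+i j≢λ₁ (λ k → trans (sym (y≗y′ k)) (e k))

InSλ-∘ : ∀ {n λ₁} {y z : Fin n → Fin n} → InSλ λ₁ y → InSλ λ₁ z → InSλ λ₁ (y ∘ z)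
InSλ-∘ {y = y} y∈ (sλ-id z≗id)               = InSλ-cong (λ x → cong y (sym (z≗id x))) y∈
InSλ-∘ {y = y} y∈ (sλ-mul z∈ i j j≡1+i j≢λ₁ e) = sλ-mul (InSλ-∘ y∈ z∈) i j j≡1+i j≢λ₁ (λ k → cong y (e k))

InSλ-transpose : ∀ {n λ₁} {i j : Fin n} → toℕ j ≡ suc (toℕ i) → toℕ j ≢ λ₁ → InSλ λ₁ (transpose i j)
InSλ-transpose {i = i} {j} j≡1+i j≢λ₁ = sλ-mul (sλ-id (λ _ → refl)) i j j≡1+i j≢λ₁ (λ _ → refl)

InλS⇒increasing-on-blocks : ∀ {n λ₁} {v : Permutation′ n} → InλS λ₁ v → ∀ {p q} → p F.< q →
  SameBlock λ₁ (v ⟨$⟩ʳ p) (v ⟨$⟩ʳ q) → v ⟨$⟩ʳ p F.< v ⟨$⟩ʳ q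
InλS⇒increasing-on-blocks {λ₁ = λ₁} {v} (small , large) {p} {q} p<q p~q
  with FP.<-cmp (v ⟨$⟩ʳ p) (v ⟨$⟩ʳ q)
... | tri< vp<vq _ _ = vp<vq
... | tri≈ _ vp≡vq _ = ⊥-elim (FP.<⇒≢ p<q (⟨$⟩ʳ-injective v vp≡vq))
... | tri> _ _ vq<vp with toℕ (v ⟨$⟩ʳ p) ℕ.<? λ₁
...   | yes vp<λ₁ = ⊥-elim (FP.<-asym p<q (back (small (v ⟨$⟩ʳ q) (v ⟨$⟩ʳ p) vq<vp vp<λ₁)))
  where back = subst₂ F._<_ (Perm.inverseˡ v) (Perm.inverseˡ v)
...   | no vp≮λ₁  = ⊥-elim (FP.<-asym p<q (back (large (v ⟨$⟩ʳ q) (v ⟨$⟩ʳ p) λ₁≤vq vq<vp)))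
  where
  back = subst₂ F._<_ (Perm.inverseˡ v) (Perm.inverseˡ v)
  λ₁≤vq = sameBlock-large p~q (NP.≮⇒≥ vp≮λ₁)

Descent : ∀ {n} → ℕ → Permutation′ n → Fin n → Fin n → Set
Descent λ₁ w i j = toℕ j ≡ suc (toℕ i) × toℕ j ≢ λ₁ × w ⟨$⟩ˡ j F.< w ⟨$⟩ˡ i

descent? : ∀ {n} λ₁ (w : Permutation′ n) → Dec (∃₂ (Descent λ₁ w))
descent? λ₁ w = FP.any? (λ i → FP.any? (λ j →
  (toℕ j ℕ.≟ suc (toℕ i)) ×-dec (¬? (toℕ j ℕ.≟ λ₁) ×-dec (w ⟨$⟩ˡ j F.<? w ⟨$⟩ˡ i))))

no-descent⇒InλS : ∀ {n λ₁} (w : Permutation′ n) → ¬ ∃₂ (Descent λ₁ w) → InλS λ₁ w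
no-descent⇒InλS {n} {λ₁} w no-descent =
  (λ a b a<b b<λ₁ → ordered z≤n a<b (λ _ m<b → NP.<⇒≢ (NP.≤-<-trans m<b b<λ₁))) ,
  (λ a b λ₁≤a a<b → ordered λ₁≤a a<b (λ λ₁≤m _ → NP.<⇒≢ (s≤s λ₁≤m) ∘ sym))
  where
  ascent : ∀ {i j} → toℕ j ≡ suc (toℕ i) → toℕ j ≢ λ₁ → w ⟨$⟩ˡ i F.< w ⟨$⟩ˡ j
  ascent {i} {j} j≡1+i j≢λ₁ = NP.≤∧≢⇒< (NP.≮⇒≥ (λ wj<wi → no-descent (i , j , j≡1+i , j≢λ₁ , wj<wi)))
    (λ e → NP.<-irrefl (cong toℕ (⟨$⟩ʳ-injective (Perm.flip w) (FP.toℕ-injective e)))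
                       (subst (toℕ i <_) (sym j≡1+i) (NP.n<1+n (toℕ i))))
  ordered : ∀ {lo} {a b : Fin n} → lo ≤ toℕ a → a F.< b →
    (∀ {m} → lo ≤ m → m < toℕ b → suc m ≢ λ₁) → w ⟨$⟩ˡ a F.< w ⟨$⟩ˡ b
  ordered {lo} {a} {b} lo≤a a<b ≢λ₁ =
    subst₂ _<_ (g-at a) (g-at b) (increasing-< g-increasing lo≤a a<b (NP.n<1+n (toℕ b)))
    where
    g : ℕ → ℕ
    g m = toℕ (w ⟨$⟩ˡ ix m b)
    g-at : ∀ x → g (toℕ x) ≡ toℕ (w ⟨$⟩ˡ x)
    g-at x = cong (λ z → toℕ (w ⟨$⟩ˡ z)) (ix-toℕ x b)
    g-increasing : IncreasingOn lo (suc (toℕ b)) g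
    g-increasing {m} lo≤m 1+m<1+b = ascent
      (trans (ix-val b 1+m<n) (cong suc (sym (ix-val b (NP.<-trans (NP.n<1+n m) 1+m<n)))))
      (≢λ₁ lo≤m (NP.≤-pred 1+m<1+b) ∘ trans (sym (ix-val b 1+m<n)))
      where 1+m<n = NP.≤-<-trans (NP.≤-pred 1+m<1+b) (FP.toℕ<n b)

record Factorisation {n} (λ₁ : ℕ) (w : Permutation′ n) : Set where
  no-eta-equality
  field
    y v  : Permutation′ n
    y∈Sλ : InSλ λ₁ (y ⟨$⟩ʳ_)
    v∈λS : InλS λ₁ v
    w≡yv : ∀ x → w ⟨$⟩ʳ x ≡ y ⟨$⟩ʳ (v ⟨$⟩ʳ x)
    v≤w  : Bruhat (v ⟨$⟩ʳ_) (w ⟨$⟩ʳ_)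

  w~v : ∀ x → SameBlock λ₁ (w ⟨$⟩ʳ x) (v ⟨$⟩ʳ x)
  w~v x = subst (λ z → SameBlock λ₁ z (v ⟨$⟩ʳ x)) (sym (w≡yv x)) (InSλ⇒sameBlock y∈Sλ (v ⟨$⟩ʳ x))

-- Induction on length: if w⁻¹(i+1) < w⁻¹(i) for a generator s_i of S_λ, then w′ = s_i w is
-- shorter and w = w′ ∘ (w⁻¹(i+1) w⁻¹(i)) is one Bruhat step above w′; without such a descent,
-- w itself lies in ^λS_n.
factorise : ∀ {n} λ₁ (w : Permutation′ n) → Factorisation λ₁ w
factorise {n} λ₁ w₀ = go w₀ (<-wellFounded (len (w₀ ⟨$⟩ʳ_)))
  where
  go : ∀ w → Acc _<_ (len (w ⟨$⟩ʳ_)) → Factorisation λ₁ w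
  go w (acc rec) with descent? λ₁ w
  ... | no no-descent = record
    { y = Perm.id ; v = w ; y∈Sλ = sλ-id (λ _ → refl) ; v∈λS = no-descent⇒InλS w no-descent
    ; w≡yv = λ _ → refl ; v≤w = br-refl (λ _ → refl) }
  ... | yes (i , j , j≡1+i , j≢λ₁ , q<p) = record
    { y = R.y ∘ₚ Perm.transpose i j
    ; v = R.v
    ; y∈Sλ = InSλ-∘ (InSλ-transpose j≡1+i j≢λ₁) R.y∈Sλ
    ; v∈λS = R.v∈λS
    ; w≡yv = λ x → trans (sym (transpose-involutive i j (w ⟨$⟩ʳ x))) (cong (transpose i j) (R.w≡yv x))
    ; v≤w = br-step R.v≤w q p q<p ascent (sym ∘ w′∘τ≗w) }
    where
    w′ = w ∘ₚ Perm.transpose i j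
    q = w ⟨$⟩ˡ j
    p = w ⟨$⟩ˡ i
    w′∘τ≗w : (λ x → w′ ⟨$⟩ʳ transpose q p x) ≗ (w ⟨$⟩ʳ_)
    w′∘τ≗w x = begin
      transpose i j (w ⟨$⟩ʳ transpose q p x)
        ≡⟨ cong (transpose i j) (transpose-conjugate w q p x) ⟩
      transpose i j (transpose (w ⟨$⟩ʳ q) (w ⟨$⟩ʳ p) (w ⟨$⟩ʳ x))
        ≡⟨ cong₂ (λ a b → transpose i j (transpose a b (w ⟨$⟩ʳ x))) (Perm.inverseʳ w) (Perm.inverseʳ w) ⟩
      transpose i j (transpose j i (w ⟨$⟩ʳ x))
        ≡⟨ transpose-inverse i j ⟩
      w ⟨$⟩ʳ x ∎
      where open ≡-Reasoning
    w′q<w′p : w′ ⟨$⟩ʳ q F.< w′ ⟨$⟩ʳ p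
    w′q<w′p = subst₂ F._<_ (sym (trans (cong (transpose i j) (Perm.inverseʳ w)) (transpose-atʳ i j)))
                           (sym (trans (cong (transpose i j) (Perm.inverseʳ w)) (transpose-atˡ i j)))
                           (subst (toℕ i <_) (sym j≡1+i) (NP.n<1+n (toℕ i)))
    ascent : len (w′ ⟨$⟩ʳ_) < len (λ x → w′ ⟨$⟩ʳ transpose q p x)
    ascent = len-transpose-ascent (w′ ⟨$⟩ʳ_) q<p w′q<w′p
    R : Factorisation λ₁ w′
    R = go w′ (rec (subst (len (w′ ⟨$⟩ʳ_) <_) (len-cong w′∘τ≗w) ascent))
    module R = Factorisation R

-- The block pattern characterising the Bruhat interval above v_k

BlockPattern : ∀ {n} (λ₁ λ₂ k : ℕ) → (Fin n → Fin n) → Set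
BlockPattern λ₁ λ₂ k w = (∀ a → toℕ a < k → λ₁ ≤ toℕ (w a)) × (∀ a → λ₂ < toℕ a → toℕ (w a) < λ₁)

blockPattern? : ∀ {n} λ₁ λ₂ k (w : Fin n → Fin n) → Dec (BlockPattern λ₁ λ₂ k w)
blockPattern? λ₁ λ₂ k w =
  FP.all? (λ a → (toℕ a ℕ.<? k) →-dec (λ₁ ℕ.≤? toℕ (w a))) ×-dec
  FP.all? (λ a → (λ₂ ℕ.<? toℕ a) →-dec (toℕ (w a) ℕ.<? λ₁))

blockPattern-sameBlock : ∀ {n λ₁ λ₂ k} {u w : Fin n → Fin n} → (∀ a → SameBlock λ₁ (u a) (w a)) →
  BlockPattern λ₁ λ₂ k u → BlockPattern λ₁ λ₂ k w
blockPattern-sameBlock u~w (upper , lower) =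
  (λ a a<k → sameBlock-large (u~w a) (upper a a<k)) ,
  (λ a λ₂<a → Equivalence.to (u~w a) (lower a λ₂<a))

blockPattern-cong : ∀ {n λ₁ λ₂ k} {u w : Fin n → Fin n} → u ≗ w →
  BlockPattern λ₁ λ₂ k u → BlockPattern λ₁ λ₂ k w
blockPattern-cong u≗w = blockPattern-sameBlock (λ a → subst (SameBlock _ _) (u≗w a) ⇔-refl)

blockPattern-ascent : ∀ {n λ₁ λ₂ k} (w : Fin n → Fin n) {i j : Fin n} → i F.< j → w i F.< w j →
  BlockPattern λ₁ λ₂ k w → BlockPattern λ₁ λ₂ k (w ∘ transpose i j)
blockPattern-ascent {λ₁ = λ₁} {λ₂} {k} w {i} {j} i<j wi<wj (upper , lower) = upper′ , lower′
  where
  upper′ : ∀ a → toℕ a < k → λ₁ ≤ toℕ (w (transpose i j a))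
  upper′ a a<k with transpose i j a | transpose-view i j a
  ... | _ | at-i      = NP.≤-trans (upper a a<k) (NP.<⇒≤ wi<wj)
  ... | _ | at-j      = upper i (NP.<-trans i<j a<k)
  ... | _ | other _ _ = upper a a<k
  lower′ : ∀ a → λ₂ < toℕ a → toℕ (w (transpose i j a)) < λ₁
  lower′ a λ₂<a with transpose i j a | transpose-view i j a
  ... | _ | at-i      = lower j (NP.<-trans λ₂<a i<j)
  ... | _ | at-j      = NP.<-trans wi<wj (lower a λ₂<a)
  ... | _ | other _ _ = lower a λ₂<a

blockPattern-bruhat : ∀ {n λ₁ λ₂ k} {u w : Fin n → Fin n} → BlockPattern λ₁ λ₂ k u → Bruhat u w →
  BlockPattern λ₁ λ₂ k w
blockPattern-bruhat pu (br-refl u≗w) = blockPattern-cong u≗w pu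
blockPattern-bruhat pu (br-step {w = w} u≤w i j i<j len< e) =
  blockPattern-cong (sym ∘ e) (blockPattern-ascent w i<j (len-<⇒ascent w i<j len<) (blockPattern-bruhat pu u≤w))

-- The permutations v_j

module TwoBlocks (l λ₂ : ℕ) where
  λ₁ = suc l
  N = λ₁ + λ₂

  vℕ-< : ∀ {j p} → p < j → vℕ λ₁ λ₂ j p ≡ λ₁ + p
  vℕ-< {j} {p} p<j with p ℕ.<? j | p ℕ.≟ j | p ℕ.≤? λ₂
  ... | yes _   | _ | _ = refl
  ... | no p≮j  | _ | _ = ⊥-elim (p≮j p<j)

  vℕ-≡ : ∀ j → vℕ λ₁ λ₂ j j ≡ 0
  vℕ-≡ j with j ℕ.<? j | j ℕ.≟ j | j ℕ.≤? λ₂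
  ... | yes j<j | _       | _ = ⊥-elim (NP.<-irrefl refl j<j)
  ... | no _    | yes _   | _ = refl
  ... | no _    | no j≢j  | _ = ⊥-elim (j≢j refl)

  vℕ-mid : ∀ {j p} → j < p → p ≤ λ₂ → vℕ λ₁ λ₂ j p ≡ l + p
  vℕ-mid {j} {p} j<p p≤λ₂ with p ℕ.<? j | p ℕ.≟ j | p ℕ.≤? λ₂
  ... | yes p<j | _       | _        = ⊥-elim (NP.<-asym p<j j<p)
  ... | no _    | yes p≡j | _        = ⊥-elim (NP.<-irrefl (sym p≡j) j<p)
  ... | no _    | no _    | yes _    = refl
  ... | no _    | no _    | no p≰λ₂  = ⊥-elim (p≰λ₂ p≤λ₂)

  vℕ-> : ∀ {j p} → j ≤ λ₂ → λ₂ < p → vℕ λ₁ λ₂ j p ≡ p ∸ λ₂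
  vℕ-> {j} {p} j≤λ₂ λ₂<p with p ℕ.<? j | p ℕ.≟ j | p ℕ.≤? λ₂
  ... | yes p<j | _       | _        = ⊥-elim (NP.<-asym λ₂<p (NP.<-≤-trans p<j j≤λ₂))
  ... | no _    | yes p≡j | _        = ⊥-elim (NP.<-irrefl (sym p≡j) (NP.≤-<-trans j≤λ₂ λ₂<p))
  ... | no _    | no _    | yes p≤λ₂ = ⊥-elim (NP.<⇒≱ λ₂<p p≤λ₂)
  ... | no _    | no _    | no _     = refl

  vℕ<N : ∀ {j p} → j ≤ λ₂ → p < N → vℕ λ₁ λ₂ j p < N
  vℕ<N {j} {p} j≤λ₂ p<N with p ℕ.<? j | p ℕ.≟ j | p ℕ.≤? λ₂
  ... | yes p<j | _    | _       = NP.+-monoʳ-< λ₁ (NP.<-≤-trans p<j j≤λ₂)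
  ... | no _    | yes _ | _      = s≤s z≤n
  ... | no _    | no _ | yes p≤λ₂ = s≤s (NP.+-monoʳ-≤ l p≤λ₂)
  ... | no _    | no _ | no _     = NP.≤-<-trans (NP.m∸n≤m p λ₂) p<N

  toℕ-vfun : ∀ {j} → j ≤ λ₂ → (x : Fin N) → toℕ (vfun λ₁ λ₂ j x) ≡ vℕ λ₁ λ₂ j (toℕ x)
  toℕ-vfun j≤λ₂ x = ix-val x (vℕ<N j≤λ₂ (FP.toℕ<n x))

  at : ℕ → Fin N
  at m = ix m F.zero

  toℕ-at : ∀ {m} → m < N → toℕ (at m) ≡ m
  toℕ-at = ix-val F.zero

  ≤λ₂⇒<N : ∀ {m} → m ≤ λ₂ → m < N
  ≤λ₂⇒<N m≤λ₂ = s≤s (NP.≤-trans m≤λ₂ (NP.m≤n+m λ₂ l))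

  ≢at⇒toℕ≢ : ∀ {x m} → m < N → x ≢ at m → toℕ x ≢ m
  ≢at⇒toℕ≢ m<N x≢at-m x≡m = x≢at-m (FP.toℕ-injective (trans x≡m (sym (toℕ-at m<N))))

  beyond<N : ∀ {m} → m < l → suc λ₂ + m < N
  beyond<N {m} m<l = subst (suc λ₂ + m <_) (cong suc (NP.+-comm λ₂ l)) (s≤s (NP.+-monoʳ-< λ₂ m<l))

  vfun-at : ∀ {j m} → j ≤ λ₂ → m < N → toℕ (vfun λ₁ λ₂ j (at m)) ≡ vℕ λ₁ λ₂ j m
  vfun-at {j} j≤λ₂ m<N = trans (toℕ-vfun j≤λ₂ _) (cong (vℕ λ₁ λ₂ j) (toℕ-at m<N))

  vℕ-suc-other : ∀ {j p} → suc j ≤ λ₂ → p ≢ j → p ≢ suc j → vℕ λ₁ λ₂ (suc j) p ≡ vℕ λ₁ λ₂ j p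
  vℕ-suc-other {j} {p} 1+j≤λ₂ p≢j p≢1+j with NP.<-cmp p j
  ... | tri< p<j _ _ = trans (vℕ-< (NP.m<n⇒m<1+n p<j)) (sym (vℕ-< p<j))
  ... | tri≈ _ p≡j _ = ⊥-elim (p≢j p≡j)
  ... | tri> _ _ j<p = above (p ℕ.≤? λ₂)
    where
    above : Dec (p ≤ λ₂) → vℕ λ₁ λ₂ (suc j) p ≡ vℕ λ₁ λ₂ j p
    above (yes p≤λ₂) = trans (vℕ-mid (NP.≤∧≢⇒< j<p (p≢1+j ∘ sym)) p≤λ₂) (sym (vℕ-mid j<p p≤λ₂))
    above (no p≰λ₂)  = trans (vℕ-> 1+j≤λ₂ (NP.≰⇒> p≰λ₂)) (sym (vℕ-> (NP.<⇒≤ 1+j≤λ₂) (NP.≰⇒> p≰λ₂)))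

  vfun-suc : ∀ {j} → suc j ≤ λ₂ → vfun λ₁ λ₂ (suc j) ≗ (vfun λ₁ λ₂ j ∘ transpose (at j) (at (suc j)))
  vfun-suc {j} 1+j≤λ₂ x with transpose (at j) (at (suc j)) x | transpose-view (at j) (at (suc j)) x
  ... | _ | at-i = FP.toℕ-injective (begin
    toℕ (vfun λ₁ λ₂ (suc j) (at j))   ≡⟨ vfun-at 1+j≤λ₂ j<N ⟩
    vℕ λ₁ λ₂ (suc j) j                ≡⟨ vℕ-< (NP.n<1+n j) ⟩
    λ₁ + j                            ≡⟨ NP.+-suc l j ⟨
    l + suc j                         ≡⟨ vℕ-mid (NP.n<1+n j) 1+j≤λ₂ ⟨
    vℕ λ₁ λ₂ j (suc j)                ≡⟨ vfun-at j≤λ₂ 1+j<N ⟨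
    toℕ (vfun λ₁ λ₂ j (at (suc j)))   ∎)
    where
    open ≡-Reasoning
    j≤λ₂ = NP.<⇒≤ 1+j≤λ₂
    1+j<N = ≤λ₂⇒<N 1+j≤λ₂
    j<N = ≤λ₂⇒<N j≤λ₂
  ... | _ | at-j = FP.toℕ-injective (begin
    toℕ (vfun λ₁ λ₂ (suc j) (at (suc j)))  ≡⟨ vfun-at 1+j≤λ₂ (≤λ₂⇒<N 1+j≤λ₂) ⟩
    vℕ λ₁ λ₂ (suc j) (suc j)               ≡⟨ vℕ-≡ (suc j) ⟩
    0                                      ≡⟨ vℕ-≡ j ⟨
    vℕ λ₁ λ₂ j j                           ≡⟨ vfun-at (NP.<⇒≤ 1+j≤λ₂) (≤λ₂⇒<N (NP.<⇒≤ 1+j≤λ₂)) ⟨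
    toℕ (vfun λ₁ λ₂ j (at j))              ∎)
    where open ≡-Reasoning
  ... | _ | other x≢at-j x≢at-1+j = FP.toℕ-injective (begin
    toℕ (vfun λ₁ λ₂ (suc j) x)  ≡⟨ toℕ-vfun 1+j≤λ₂ x ⟩
    vℕ λ₁ λ₂ (suc j) (toℕ x)    ≡⟨ vℕ-suc-other 1+j≤λ₂ (≢at⇒toℕ≢ (≤λ₂⇒<N (NP.<⇒≤ 1+j≤λ₂)) x≢at-j)
                                                     (≢at⇒toℕ≢ (≤λ₂⇒<N 1+j≤λ₂) x≢at-1+j) ⟩
    vℕ λ₁ λ₂ j (toℕ x)          ≡⟨ toℕ-vfun (NP.<⇒≤ 1+j≤λ₂) x ⟨
    toℕ (vfun λ₁ λ₂ j x)        ∎)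
    where open ≡-Reasoning

  vfun-ascent : ∀ {j} → suc j ≤ λ₂ → vfun λ₁ λ₂ j (at j) F.< vfun λ₁ λ₂ j (at (suc j))
  vfun-ascent {j} 1+j≤λ₂ = subst₂ _<_ (sym (trans (vfun-at j≤λ₂ (≤λ₂⇒<N j≤λ₂)) (vℕ-≡ j)))
                                     (sym (trans (vfun-at j≤λ₂ (≤λ₂⇒<N 1+j≤λ₂)) (vℕ-mid (NP.n<1+n j) 1+j≤λ₂)))
                                     (subst (0 <_) (sym (NP.+-suc l j)) (s≤s z≤n))
    where j≤λ₂ = NP.<⇒≤ 1+j≤λ₂

  at-< : ∀ {j} → suc j ≤ λ₂ → at j F.< at (suc j)
  at-< {j} 1+j≤λ₂ = subst₂ _<_ (sym (toℕ-at (≤λ₂⇒<N (NP.<⇒≤ 1+j≤λ₂)))) (sym (toℕ-at (≤λ₂⇒<N 1+j≤λ₂))) (NP.n<1+n j)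

  vfun-bruhat : ∀ {k j} → k ≤ j → j ≤ λ₂ → Bruhat (vfun {N} λ₁ λ₂ k) (vfun λ₁ λ₂ j)
  vfun-bruhat {k} {zero}  z≤n     _      = br-refl (λ _ → refl)
  vfun-bruhat {k} {suc j} k≤1+j 1+j≤λ₂ with k ℕ.≟ suc j
  ... | yes refl = br-refl (λ _ → refl)
  ... | no k≢1+j = br-step (vfun-bruhat (NP.≤-pred (NP.≤∧≢⇒< k≤1+j k≢1+j)) (NP.<⇒≤ 1+j≤λ₂))
                           (at j) (at (suc j)) (at-< 1+j≤λ₂)
                           (len-transpose-ascent (vfun λ₁ λ₂ j) (at-< 1+j≤λ₂) (vfun-ascent 1+j≤λ₂))
                           (vfun-suc 1+j≤λ₂)

  vfun-blockPattern : ∀ {k j} → k ≤ j → j ≤ λ₂ → BlockPattern λ₁ λ₂ k (vfun {N} λ₁ λ₂ j)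
  vfun-blockPattern {k} {j} k≤j j≤λ₂ = upper , lower
    where
    upper : ∀ a → toℕ a < k → λ₁ ≤ toℕ (vfun λ₁ λ₂ j a)
    upper a a<k = subst (λ₁ ≤_) (sym (trans (toℕ-vfun j≤λ₂ a) (vℕ-< (NP.<-≤-trans a<k k≤j))))
                        (NP.m≤m+n λ₁ (toℕ a))
    lower : ∀ a → λ₂ < toℕ a → toℕ (vfun λ₁ λ₂ j a) < λ₁
    lower a λ₂<a = subst (_< λ₁) (sym (trans (toℕ-vfun j≤λ₂ a) (vℕ-> j≤λ₂ λ₂<a)))
                         (NP.m<n+o⇒m∸n<o (toℕ a) λ₂ (subst (toℕ a <_) (NP.+-comm λ₁ λ₂) (FP.toℕ<n a)))

  vfun-separated : ∀ {j j′} → j ≤ λ₂ → j′ ≤ λ₂ → j ≢ j′ →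
    ¬ SameBlock λ₁ (vfun λ₁ λ₂ j (at j)) (vfun λ₁ λ₂ j′ (at j))
  vfun-separated {j} {j′} j≤λ₂ j′≤λ₂ j≢j′ same =
    NP.<⇒≱ (Equivalence.to same (subst (_< λ₁) (sym (trans (vfun-at j≤λ₂ j<N) (vℕ-≡ j))) (s≤s z≤n)))
           (subst (λ₁ ≤_) (sym (vfun-at j′≤λ₂ j<N)) (large (NP.<-cmp j j′)))
    where
    j<N = ≤λ₂⇒<N j≤λ₂
    large : Tri (j < j′) (j ≡ j′) (j′ < j) → λ₁ ≤ vℕ λ₁ λ₂ j′ j
    large (tri< j<j′ _ _) = subst (λ₁ ≤_) (sym (vℕ-< j<j′)) (NP.m≤m+n λ₁ j)
    large (tri≈ _ j≡j′ _) = ⊥-elim (j≢j′ j≡j′)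
    large (tri> _ _ j′<j) = subst (λ₁ ≤_) (sym (vℕ-mid j′<j j≤λ₂)) (λ₁≤l+j j′<j)
      where
      λ₁≤l+j : ∀ {m} → j′ < m → λ₁ ≤ l + m
      λ₁≤l+j {suc m} _ = subst (λ₁ ≤_) (sym (NP.+-suc l m)) (s≤s (NP.m≤m+n l m))

  -- Counting from 0, with j the position of the value 0: the positions after λ₂ carry 1, …, λ₁ - 1
  -- in order, and then the positions up to λ₂ other than j carry λ₁, …, N - 1 in order
  -- (increasing-in-interval).
  module _ {k} (v : Permutation′ N) (v∈λS : InλS λ₁ v) (v-pattern : BlockPattern λ₁ λ₂ k (v ⟨$⟩ʳ_)) where
    private
      φ : ℕ → ℕ
      φ p = toℕ (v ⟨$⟩ʳ at p)

      φ-toℕ : ∀ x → φ (toℕ x) ≡ toℕ (v ⟨$⟩ʳ x)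
      φ-toℕ x = cong (λ z → toℕ (v ⟨$⟩ʳ z)) (ix-toℕ x F.zero)

      φ-injective : ∀ {p q} → p < N → q < N → φ p ≡ φ q → p ≡ q
      φ-injective p<N q<N φp≡φq =
        trans (sym (toℕ-at p<N)) (trans (cong toℕ (⟨$⟩ʳ-injective v (FP.toℕ-injective φp≡φq))) (toℕ-at q<N))

      φ-< : ∀ {p q} → p < q → q < N → SameBlock λ₁ (v ⟨$⟩ʳ at p) (v ⟨$⟩ʳ at q) → φ p < φ q
      φ-< {p} {q} p<q q<N = InλS⇒increasing-on-blocks {v = v} v∈λS
        (subst₂ _<_ (sym (toℕ-at (NP.<-trans p<q q<N))) (sym (toℕ-at q<N)) p<q)

      φ-upper : ∀ {p} → p < k → p < N → λ₁ ≤ φ p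
      φ-upper {p} p<k p<N = proj₁ v-pattern (at p) (subst (_< k) (sym (toℕ-at p<N)) p<k)

      φ-lower : ∀ {p} → λ₂ < p → p < N → φ p < λ₁
      φ-lower {p} λ₂<p p<N = proj₂ v-pattern (at p) (subst (λ₂ <_) (sym (toℕ-at p<N)) λ₂<p)

      G : ℕ → ℕ
      G a = toℕ (v ⟨$⟩ˡ at a)

      G-increasing : IncreasingOn 0 λ₁ G
      G-increasing {m} _ 1+m<λ₁ = proj₁ v∈λS (at m) (at (suc m))
        (subst₂ _<_ (sym (toℕ-at m<N)) (sym (toℕ-at 1+m<N)) (NP.n<1+n m))
        (subst (_< λ₁) (sym (toℕ-at 1+m<N)) 1+m<λ₁)
        where
        1+m<N = NP.<-≤-trans 1+m<λ₁ (NP.m≤m+n λ₁ λ₂)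
        m<N = NP.<-trans (NP.n<1+n m) 1+m<N

      j : ℕ
      j = G 0

      φj≡0 : φ j ≡ 0
      φj≡0 = trans (cong (λ z → toℕ (v ⟨$⟩ʳ z)) (ix-toℕ (v ⟨$⟩ˡ at 0) F.zero))
                   (trans (cong toℕ (Perm.inverseʳ v)) (toℕ-at (s≤s z≤n)))

      φ≡0⇒j : ∀ {p} → p < N → φ p ≡ 0 → p ≡ j
      φ≡0⇒j p<N φp≡0 = φ-injective p<N (FP.toℕ<n (v ⟨$⟩ˡ at 0)) (trans φp≡0 (sym φj≡0))

      j≤λ₂ : j ≤ λ₂
      j≤λ₂ = NP.+-cancelʳ-≤ l j λ₂ (NP.≤-pred (begin-strict
        j + l       ≤⟨ increasing-+ G-increasing 0 l (NP.n<1+n l) ⟩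
        G l         <⟨ FP.toℕ<n (v ⟨$⟩ˡ at l) ⟩
        N           ≡⟨ cong suc (NP.+-comm l λ₂) ⟩
        suc λ₂ + l  ∎))
        where open NP.≤-Reasoning

      k≤j : k ≤ j
      k≤j = NP.≮⇒≥ λ j<k → NP.n≮0 (subst (λ₁ ≤_) φj≡0 (φ-upper j<k (≤λ₂⇒<N j≤λ₂)))

      φ-beyond-λ₂ : ∀ {m} → m < l → φ (suc λ₂ + m) ≡ 1 + m
      φ-beyond-λ₂ = increasing-in-interval {f = λ m → φ (suc λ₂ + m)} increasing bounds
        where
        λ₂< : ∀ m → λ₂ < suc λ₂ + m
        λ₂< m = s≤s (NP.m≤m+n λ₂ m)
        increasing : IncreasingOn 0 l (λ m → φ (suc λ₂ + m))
        increasing {m} _ 1+m<l = φ-< (NP.+-monoʳ-< (suc λ₂) (NP.n<1+n m)) (beyond<N 1+m<l)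
          (small-sameBlock (φ-lower (λ₂< m) (beyond<N (NP.<-trans (NP.n<1+n m) 1+m<l)))
                           (φ-lower (λ₂< (suc m)) (beyond<N 1+m<l)))
        bounds : ∀ {m} → m < l → 1 ≤ φ (suc λ₂ + m) × φ (suc λ₂ + m) < 1 + l
        bounds {m} m<l =
          NP.n≢0⇒n>0 (λ φ≡0 → NP.<⇒≢ (NP.≤-<-trans j≤λ₂ (λ₂< m)) (sym (φ≡0⇒j (beyond<N m<l) φ≡0))) ,
          φ-lower (λ₂< m) (beyond<N m<l)

      φ-large : ∀ {p} → p ≤ λ₂ → p ≢ j → λ₁ ≤ φ p
      φ-large {p} p≤λ₂ p≢j = NP.≮⇒≥ (small (φ p) refl)
        where
        small : ∀ a → φ p ≡ a → ¬ (a < λ₁)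
        small zero    φp≡0    _       = p≢j (φ≡0⇒j (≤λ₂⇒<N p≤λ₂) φp≡0)
        small (suc b) φp≡1+b 1+b<λ₁ = NP.<⇒≱ (s≤s (NP.m≤m+n λ₂ b)) (subst (_≤ λ₂) p≡λ₂+1+b p≤λ₂)
          where
          b<l = NP.≤-pred 1+b<λ₁
          p≡λ₂+1+b : p ≡ suc λ₂ + b
          p≡λ₂+1+b = φ-injective (≤λ₂⇒<N p≤λ₂) (beyond<N b<l) (trans φp≡1+b (sym (φ-beyond-λ₂ b<l)))

      φ-up-to-λ₂ : ∀ {m} → m < λ₂ → φ (skip j m) ≡ λ₁ + m
      φ-up-to-λ₂ = increasing-in-interval {f = φ ∘ skip j} increasing bounds
        where
        large : ∀ m → m < λ₂ → λ₁ ≤ φ (skip j m)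
        large m m<λ₂ = φ-large (skip-≤ m<λ₂) (skip-≢ j m)
        increasing : IncreasingOn 0 λ₂ (φ ∘ skip j)
        increasing {m} _ 1+m<λ₂ = φ-< (skip-increasing j m) (≤λ₂⇒<N (skip-≤ 1+m<λ₂))
          (large-sameBlock (large m (NP.<-trans (NP.n<1+n m) 1+m<λ₂)) (large (suc m) 1+m<λ₂))
        bounds : ∀ {m} → m < λ₂ → λ₁ ≤ φ (skip j m) × φ (skip j m) < λ₁ + λ₂
        bounds {m} m<λ₂ = large m m<λ₂ , FP.toℕ<n (v ⟨$⟩ʳ at (skip j m))

      φ≡vℕ : ∀ {p} → p < N → φ p ≡ vℕ λ₁ λ₂ j p
      φ≡vℕ {p} p<N with NP.<-cmp p j
      ... | tri< p<j _ _ = begin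
        φ p               ≡⟨ cong φ (skip-below p<j) ⟨
        φ (skip j p)      ≡⟨ φ-up-to-λ₂ (NP.<-≤-trans p<j j≤λ₂) ⟩
        λ₁ + p            ≡⟨ vℕ-< p<j ⟨
        vℕ λ₁ λ₂ j p      ∎
        where open ≡-Reasoning
      ... | tri≈ _ refl _ = trans φj≡0 (sym (vℕ-≡ j))
      ... | tri> _ _ j<p = beyond j<p (p ℕ.≤? λ₂)
        where
        open ≡-Reasoning
        middle : ∀ {q} → j < q → q ≤ λ₂ → φ q ≡ vℕ λ₁ λ₂ j q
        middle {suc m} (s≤s j≤m) 1+m≤λ₂ = begin
          φ (suc m)          ≡⟨ cong φ (skip-above j≤m) ⟨
          φ (skip j m)       ≡⟨ φ-up-to-λ₂ 1+m≤λ₂ ⟩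
          λ₁ + m             ≡⟨ NP.+-suc l m ⟨
          l + suc m          ≡⟨ vℕ-mid (s≤s j≤m) 1+m≤λ₂ ⟨
          vℕ λ₁ λ₂ j (suc m) ∎
        far : ∀ {m} → m < l → φ (suc λ₂ + m) ≡ vℕ λ₁ λ₂ j (suc λ₂ + m)
        far {m} m<l = begin
          φ (suc λ₂ + m)              ≡⟨ φ-beyond-λ₂ m<l ⟩
          suc m                       ≡⟨ NP.m+n∸m≡n λ₂ (suc m) ⟨
          λ₂ + suc m ∸ λ₂             ≡⟨ cong (_∸ λ₂) (NP.+-suc λ₂ m) ⟩
          suc λ₂ + m ∸ λ₂             ≡⟨ vℕ-> j≤λ₂ (s≤s (NP.m≤m+n λ₂ m)) ⟨
          vℕ λ₁ λ₂ j (suc λ₂ + m)     ∎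
        beyond : j < p → Dec (p ≤ λ₂) → φ p ≡ vℕ λ₁ λ₂ j p
        beyond j<p (yes p≤λ₂) = middle j<p p≤λ₂
        beyond _   (no p≰λ₂)  = subst (λ q → φ q ≡ vℕ λ₁ λ₂ j q) λ₂+1+m≡p (far m<l)
          where
          m = p ∸ suc λ₂
          λ₂+1+m≡p : suc λ₂ + m ≡ p
          λ₂+1+m≡p = NP.m+[n∸m]≡n (NP.≰⇒> p≰λ₂)
          m<l : m < l
          m<l = NP.+-cancelˡ-< (suc λ₂) m l
                  (subst₂ _<_ (sym λ₂+1+m≡p) (cong suc (NP.+-comm l λ₂)) p<N)

    InλS-blockPattern⇒vfun : Σ ℕ λ j → k ≤ j × j ≤ λ₂ × (v ⟨$⟩ʳ_) ≗ vfun λ₁ λ₂ j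
    InλS-blockPattern⇒vfun = j , k≤j , j≤λ₂ ,
      λ x → FP.toℕ-injective (trans (sym (φ-toℕ x)) (trans (φ≡vℕ (FP.toℕ<n x)) (sym (toℕ-vfun j≤λ₂ x))))

  coset-sameBlock : ∀ j (w : Permutation′ N) → InCoset λ₁ λ₂ j w → ∀ x → SameBlock λ₁ (w ⟨$⟩ʳ x) (vfun λ₁ λ₂ j x)
  coset-sameBlock j w (y , y∈Sλ , w≡yvj) x =
    subst (λ z → SameBlock λ₁ z (vfun λ₁ λ₂ j x)) (sym (w≡yvj x)) (InSλ⇒sameBlock y∈Sλ (vfun λ₁ λ₂ j x))

  coset-unique : ∀ (w : Permutation′ N) j j′ → j ≤ λ₂ → j′ ≤ λ₂ →
    InCoset λ₁ λ₂ j w → InCoset λ₁ λ₂ j′ w → j ≡ j′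
  coset-unique w j j′ j≤λ₂ j′≤λ₂ w∈j w∈j′ with j ℕ.≟ j′
  ... | yes j≡j′ = j≡j′
  ... | no j≢j′  = ⊥-elim (vfun-separated {j} {j′} j≤λ₂ j′≤λ₂ j≢j′
        (⇔-trans (⇔-sym (coset-sameBlock j w w∈j (at j))) (coset-sameBlock j′ w w∈j′ (at j))))

  module _ {k} (k≤λ₂ : k ≤ λ₂) where

    bruhat⇔blockPattern : (w : Permutation′ N) →
      Bruhat (vfun λ₁ λ₂ k) (w ⟨$⟩ʳ_) ⇔ BlockPattern λ₁ λ₂ k (w ⟨$⟩ʳ_)
    bruhat⇔blockPattern w = mk⇔ (blockPattern-bruhat (vfun-blockPattern NP.≤-refl k≤λ₂)) above
      where
      open Factorisation (factorise λ₁ w)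
      above : BlockPattern λ₁ λ₂ k (w ⟨$⟩ʳ_) → Bruhat (vfun λ₁ λ₂ k) (w ⟨$⟩ʳ_)
      above w-pattern with InλS-blockPattern⇒vfun v v∈λS (blockPattern-sameBlock w~v w-pattern)
      ... | j , k≤j , j≤λ₂ , v≗vj = bruhat-trans (bruhat-cong (vfun-bruhat k≤j j≤λ₂) (sym ∘ v≗vj)) v≤w

    blockPattern⇔coset : (w : Permutation′ N) →
      BlockPattern λ₁ λ₂ k (w ⟨$⟩ʳ_) ⇔ (Σ ℕ λ j → k ≤ j × j ≤ λ₂ × InCoset λ₁ λ₂ j w)
    blockPattern⇔coset w = mk⇔ to from
      where
      open Factorisation (factorise λ₁ w)
      to : BlockPattern λ₁ λ₂ k (w ⟨$⟩ʳ_) → Σ ℕ λ j → k ≤ j × j ≤ λ₂ × InCoset λ₁ λ₂ j w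
      to w-pattern with InλS-blockPattern⇒vfun v v∈λS (blockPattern-sameBlock w~v w-pattern)
      ... | j , k≤j , j≤λ₂ , v≗vj =
        j , k≤j , j≤λ₂ , (y ⟨$⟩ʳ_) , y∈Sλ , λ x → trans (w≡yv x) (cong (y ⟨$⟩ʳ_) (v≗vj x))
      from : (Σ ℕ λ j → k ≤ j × j ≤ λ₂ × InCoset λ₁ λ₂ j w) → BlockPattern λ₁ λ₂ k (w ⟨$⟩ʳ_)
      from (j , k≤j , j≤λ₂ , w∈j) =
        blockPattern-sameBlock (λ x → ⇔-sym (coset-sameBlock j w w∈j x)) (vfun-blockPattern k≤j j≤λ₂)

-- The function f^{(k)}_λ

prodSk-nonzero : ∀ {n} λ₁ λ₂ h k (y : Permutation′ n) → ¬ (prodSk λ₁ λ₂ h k y ≈P 0P)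
prodSk-nonzero {n} λ₁ λ₂ h k y prod≈0 = product-nonzero (Sk λ₁ λ₂ h k) distinct (prod≈0 x₀)
  where
  x₀ : Fin n → ℤ
  x₀ i = ℤ.+ toℕ i
  product-nonzero : ∀ ps → All (λ ab → proj₁ ab ≢ proj₂ ab) ps →
    foldr (λ ab r → (x₀ (y ⟨$⟩ʳ proj₁ ab) ℤ.- x₀ (y ⟨$⟩ʳ proj₂ ab)) ℤ.* r) ℤ.1ℤ ps ≢ ℤ.0ℤ
  product-nonzero []             []                 ()
  product-nonzero ((a , b) ∷ ps) (a≢b ∷ distinct′) prod≡0 with ZP.i*j≡0⇒i≡0∨j≡0 _ prod≡0
  ... | inj₁ diff≡0 = a≢b (⟨$⟩ʳ-injective y (FP.toℕ-injective (ZP.+-injective (ZP.i-j≡0⇒i≡j _ _ diff≡0))))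
  ... | inj₂ rest≡0 = product-nonzero ps distinct′ rest≡0
  distinct : All (λ ab → proj₁ ab ≢ proj₂ ab) (Sk λ₁ λ₂ h k)
  distinct = All.map (FP.<⇒≢ ∘ proj₁) (AllP.all-filter _ (pairs n))

module FProperties {l λ₂ k : ℕ} (k≤λ₂ : k ≤ λ₂) (h : Fin (suc l + λ₂) → Fin (suc l + λ₂))
                    (f : Permutation′ (suc l + λ₂) → Poly (suc l + λ₂)) (f-spec : IsF (suc l) λ₂ h k f) where
  open TwoBlocks l λ₂

  private
    f-cong : ∀ w w′ → (∀ i → w ⟨$⟩ʳ i ≡ w′ ⟨$⟩ʳ i) → f w ≈P f w′
    f-cong = proj₁ f-spec

    f-above : ∀ y v → InSλ λ₁ (y ⟨$⟩ʳ_) → InλS λ₁ v → Bruhat (vfun λ₁ λ₂ k) (v ⟨$⟩ʳ_) →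
      f (y · v) ≈P prodSk λ₁ λ₂ h k y
    f-above y v y∈Sλ v∈λS = proj₁ (proj₂ f-spec y v y∈Sλ v∈λS)

    f-not-above : ∀ y v → InSλ λ₁ (y ⟨$⟩ʳ_) → InλS λ₁ v → ¬ Bruhat (vfun λ₁ λ₂ k) (v ⟨$⟩ʳ_) →
      f (y · v) ≈P 0P
    f-not-above y v y∈Sλ v∈λS = proj₂ (proj₂ f-spec y v y∈Sλ v∈λS)

    bruhat? : ∀ w → Dec (Bruhat (vfun λ₁ λ₂ k) (w ⟨$⟩ʳ_))
    bruhat? w = Dec.map (⇔-sym (bruhat⇔blockPattern k≤λ₂ w)) (blockPattern? λ₁ λ₂ k (w ⟨$⟩ʳ_))

  f-nonzero⇔bruhat : ∀ w → (¬ (f w ≈P 0P)) ⇔ Bruhat (vfun λ₁ λ₂ k) (w ⟨$⟩ʳ_)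
  f-nonzero⇔bruhat w = by-cases (bruhat? v)
    where
    open Factorisation (factorise λ₁ w)
    f-w : f w ≈P f (y · v)
    f-w = f-cong w (y · v) w≡yv
    v⇔w : Bruhat (vfun λ₁ λ₂ k) (v ⟨$⟩ʳ_) ⇔ Bruhat (vfun λ₁ λ₂ k) (w ⟨$⟩ʳ_)
    v⇔w = ⇔-trans (bruhat⇔blockPattern k≤λ₂ v)
         (⇔-trans (mk⇔ (blockPattern-sameBlock (⇔-sym ∘ w~v)) (blockPattern-sameBlock w~v))
                  (⇔-sym (bruhat⇔blockPattern k≤λ₂ w)))
    by-cases : Dec (Bruhat (vfun λ₁ λ₂ k) (v ⟨$⟩ʳ_)) → (¬ (f w ≈P 0P)) ⇔ Bruhat (vfun λ₁ λ₂ k) (w ⟨$⟩ʳ_)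
    by-cases (yes vk≤v) = mk⇔ (λ _ → Equivalence.to v⇔w vk≤v)
      (λ _ fw≈0 → prodSk-nonzero λ₁ λ₂ h k y
         (λ x → trans (sym (f-above y v y∈Sλ v∈λS vk≤v x)) (trans (sym (f-w x)) (fw≈0 x))))
    by-cases (no vk≰v) = mk⇔ (λ fw≉0 → ⊥-elim (fw≉0 (λ x → trans (f-w x) (f-not-above y v y∈Sλ v∈λS vk≰v x))))
      (λ vk≤w → ⊥-elim (vk≰v (Equivalence.from v⇔w vk≤w)))

  f-coset : ∀ y v → InSλ λ₁ (y ⟨$⟩ʳ_) → InλS λ₁ v → f (y · v) ≈P act y (f v)
  f-coset y v y∈Sλ v∈λS x = by-cases (bruhat? v)
    where
    f-v : f v ≈P f (Perm.id · v)
    f-v = f-cong v (Perm.id · v) (λ _ → refl)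
    id∈Sλ : InSλ λ₁ (Perm.id ⟨$⟩ʳ_)
    id∈Sλ = sλ-id (λ _ → refl)
    by-cases : Dec (Bruhat (vfun λ₁ λ₂ k) (v ⟨$⟩ʳ_)) → f (y · v) x ≡ act y (f v) x
    by-cases (yes vk≤v) = trans (f-above y v y∈Sλ v∈λS vk≤v x)
                                (sym (trans (f-v _) (f-above Perm.id v id∈Sλ v∈λS vk≤v _)))
    by-cases (no vk≰v)  = trans (f-not-above y v y∈Sλ v∈λS vk≰v x)
                                (sym (trans (f-v _) (f-not-above Perm.id v id∈Sλ v∈λS vk≰v _)))

  f-equivariant : ∀ y → InSλ λ₁ (y ⟨$⟩ʳ_) → ∀ w → f (y · w) ≈P act y (f w)
  f-equivariant y y∈Sλ w x = begin
    f (y · w) x                   ≡⟨ f-cong (y · w) ((y · y′) · v) (cong (y ⟨$⟩ʳ_) ∘ w≡yv) x ⟩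
    f ((y · y′) · v) x            ≡⟨ f-coset (y · y′) v (InSλ-∘ y∈Sλ y′∈Sλ) v∈λS x ⟩
    act y (act y′ (f v)) x        ≡⟨ f-coset y′ v y′∈Sλ v∈λS _ ⟨
    act y (f (y′ · v)) x          ≡⟨ f-cong w (y′ · v) w≡yv _ ⟨
    act y (f w) x                 ∎
    where
    open ≡-Reasoning
    open Factorisation (factorise λ₁ w) renaming (y to y′; y∈Sλ to y′∈Sλ)

  f-dot-invariant : ∀ y → InSλ λ₁ (y ⟨$⟩ʳ_) → ∀ w → act y (f (inv y · w)) ≈P f w
  f-dot-invariant y y∈Sλ w x =
    trans (sym (f-equivariant y y∈Sλ (inv y · w) x)) (f-cong (y · (inv y · w)) w (λ _ → Perm.inverseʳ y) x)

lemma4p5 : (λ₁ λ₂ : ℕ) → 1 ≤ λ₁ → 1 ≤ λ₂ →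
    (h : Fin (λ₁ + λ₂) → Fin (λ₁ + λ₂)) → IsHessenberg h →
    (k : ℕ) → k ≤ λ₂ →
    (f : Permutation′ (λ₁ + λ₂) → Poly (λ₁ + λ₂)) → IsF λ₁ λ₂ h k f →
    ((∀ (w : Permutation′ (λ₁ + λ₂)) → (¬ (f w ≈P 0P)) ⇔ (Σ ℕ λ j → k ≤ j × j ≤ λ₂ × InCoset λ₁ λ₂ j w)) ×
     (∀ (w : Permutation′ (λ₁ + λ₂)) j j' → j ≤ λ₂ → j' ≤ λ₂ → InCoset λ₁ λ₂ j w → InCoset λ₁ λ₂ j' w → j ≡ j') ×
     (∀ (w : Permutation′ (λ₁ + λ₂)) → (¬ (f w ≈P 0P)) ⇔ Bruhat (vfun λ₁ λ₂ k) (w ⟨$⟩ʳ_))) ×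
    (∀ (y : Permutation′ (λ₁ + λ₂)) → InSλ λ₁ (y ⟨$⟩ʳ_) → ∀ (w : Permutation′ (λ₁ + λ₂)) → act y (f (inv y · w)) ≈P f w) ×
    (∀ (y : Permutation′ (λ₁ + λ₂)) → InSλ λ₁ (y ⟨$⟩ʳ_) → ∀ (w : Permutation′ (λ₁ + λ₂)) → f (y · w) ≈P act y (f w))
lemma4p5 (suc l) λ₂ (s≤s z≤n) _ h _ k k≤λ₂ f f-spec =
  ( (λ w → ⇔-trans (f-nonzero⇔bruhat w) (⇔-trans (bruhat⇔blockPattern k≤λ₂ w) (blockPattern⇔coset k≤λ₂ w)))
  , coset-unique
  , f-nonzero⇔bruhat )
  , f-dot-invariant
  , f-equivariant
  where
  open TwoBlocks l λ₂
  open FProperties k≤λ₂ h f f-spec
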